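{- Let $(C,\sqsubseteq)$ be a complete lattice, $b\colon C\to C$ a monotone map and $f\in C$. Let $[C\to C]$ be the complete lattice of monotone maps on $C$ ordered pointwise and $B\colon[C\to C]\to[C\to C]$ defined by $B(a)=\bigsqcup\{c\in[C\to C]\mid c\circ b\sqsubseteq b\circ a,\ c(f)\sqsubseteq f\}$. Then $\omega_{b,f}=\nu B$, the greatest fixed point of $B$.
   Context: A monotone map $a\colon C\to C$ is $(b,f)$-compatible iff $a(f)\sqsubseteq f$ and $a\circ b\sqsubseteq b\circ a$. The $f$-companion of $b$ is $\omega_{b,f}=\bigsqcup\{a\mid a \text{ monotone and }(b,f)\text{ -compatible}\}$ (pointwise join). -}

module Defs where

open import Level using (Level; _⊔_; suc)
open import Data.Product using (Σ; _×_; _,_; proj₁; proj₂)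
open import Function using (_∘_)
open import Relation.Binary.Bundles using (Poset)

record CompleteLattice (c ℓ₁ ℓ₂ ι : Level) : Set (suc (c ⊔ ℓ₁ ⊔ ℓ₂ ⊔ ι)) where
  field
    poset : Poset c ℓ₁ ℓ₂
  open Poset poset public
  field
    ⨆       : {I : Set ι} → (I → Carrier) → Carrier
    ⨆-upper : {I : Set ι} (g : I → Carrier) (i : I) → g i ≤ ⨆ g
    ⨆-least : {I : Set ι} (g : I → Carrier) (z : Carrier) →
              (∀ i → g i ≤ z) → ⨆ g ≤ z

module _ {c ℓ₁ ℓ₂ : Level} (L : CompleteLattice c ℓ₁ ℓ₂ (c ⊔ ℓ₂)) where
  open CompleteLattice L

  record Mono : Set (c ⊔ ℓ₂) where
    constructor mono
    field
      fun       : Carrier → Carrier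
      monotone  : ∀ {x y} → x ≤ y → fun x ≤ fun y
  open Mono public

  _⊑ₘ_ : Mono → Mono → Set (c ⊔ ℓ₂)
  a ⊑ₘ a' = ∀ x → fun a x ≤ fun a' x

  _≈ₘ_ : Mono → Mono → Set (c ⊔ ℓ₁)
  a ≈ₘ a' = ∀ x → fun a x ≈ fun a' x

  ⨆ₘ : {I : Set (c ⊔ ℓ₂)} → (I → Mono) → Mono
  ⨆ₘ {I} F = mono (λ x → ⨆ (λ i → fun (F i) x))
    (λ {x} {y} x≤y → ⨆-least _ _ (λ i →
       trans (monotone (F i) x≤y) (⨆-upper (λ j → fun (F j) y) i)))

  Compatible : Mono → Carrier → Mono → Set (c ⊔ ℓ₂)
  Compatible b f a = (fun a f ≤ f) × (∀ x → fun a (fun b x) ≤ fun b (fun a x))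

  companion : Mono → Carrier → Mono
  companion b f = ⨆ₘ {I = Σ Mono (Compatible b f)} proj₁

  B : Mono → Carrier → Mono → Mono
  B b f a = ⨆ₘ {I = Σ Mono (λ d → (∀ x → fun d (fun b x) ≤ fun b (fun a x))
                                 × (fun d f ≤ f))} proj₁

  IsGreatestFixedPoint : (Mono → Mono) → Mono → Set (c ⊔ ℓ₁ ⊔ ℓ₂)
  IsGreatestFixedPoint Φ x = (Φ x ≈ₘ x) × (∀ y → Φ y ≈ₘ y → y ⊑ₘ x)

module Submission where

-- Write a ⊑ a' for the pointwise order on monotone maps and
-- ω for the f-companion of b.  By its definition, B a is the largest map d
-- with d ∘ b ⊑ b ∘ a and d(f) ⊑ f; in particular B a itself has these two
-- properties.  From this one sees that the post-fixed points of B are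
-- exactly the (b,f)-compatible maps:  a ⊑ B a  iff  a is compatible.
-- Moreover B maps compatible maps to compatible maps, because
-- B a ∘ b ⊑ b ∘ a ⊑ b ∘ B a when a ⊑ B a, using monotonicity of b.
--
-- The theorem then follows as in Knaster–Tarski: ω is compatible (a join
-- of compatible maps is compatible), hence ω ⊑ B ω; B ω is compatible,
-- hence B ω ⊑ ω, so ω is a fixed point; and any fixed point y of B is a
-- post-fixed point, hence compatible, hence y ⊑ ω.

open import Defs
open import Level using (Level; _⊔_)
open import Data.Product using (_,_; proj₁; proj₂)

module CompanionFixedPoint {c ℓ₁ ℓ₂ : Level} (L : CompleteLattice c ℓ₁ ℓ₂ (c ⊔ ℓ₂))
                           (b : Mono L) (f : CompleteLattice.Carrier L) where
  open CompleteLattice L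

  _⊑_ : Mono L → Mono L → Set (c ⊔ ℓ₂)
  _⊑_ = _⊑ₘ_ L

  _≈ᴹ_ : Mono L → Mono L → Set (c ⊔ ℓ₁)
  _≈ᴹ_ = _≈ₘ_ L

  ω : Mono L
  ω = companion L b f

  compatible⇒⊑ω : ∀ a → Compatible L b f a → a ⊑ ω
  compatible⇒⊑ω a compat x = ⨆-upper (λ j → fun (proj₁ j) x) (a , compat)

  -- The companion is itself compatible: both defining inequalities pass
  -- to the join, the second one using a ⊑ ω and monotonicity of b.
  ω-compatible : Compatible L b f ω
  ω-compatible = ⨆-least _ _ (λ j → proj₁ (proj₂ j))
               , λ x → ⨆-least _ _ (λ j →
                   trans (proj₂ (proj₂ j) x)
                         (monotone b (compatible⇒⊑ω (proj₁ j) (proj₂ j) x)))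

  ⊑B : ∀ a d → (∀ x → fun d (fun b x) ≤ fun b (fun a x)) → fun d f ≤ f →
       d ⊑ B L b f a
  ⊑B a d d∘b⊑b∘a df≤f x =
    ⨆-upper (λ j → fun (proj₁ j) x) (d , d∘b⊑b∘a , df≤f)

  B-below-f : ∀ a → fun (B L b f a) f ≤ f
  B-below-f a = ⨆-least _ _ (λ j → proj₂ (proj₂ j))

  B-after-b : ∀ a x → fun (B L b f a) (fun b x) ≤ fun b (fun a x)
  B-after-b a x = ⨆-least _ _ (λ j → proj₁ (proj₂ j) x)

  compatible⇒postfixed : ∀ a → Compatible L b f a → a ⊑ B L b f a
  compatible⇒postfixed a (af≤f , a∘b⊑b∘a) = ⊑B a a a∘b⊑b∘a af≤f

  postfixed⇒compatible : ∀ a → a ⊑ B L b f a → Compatible L b f a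
  postfixed⇒compatible a a⊑Ba =
      trans (a⊑Ba f) (B-below-f a)
    , λ x → trans (a⊑Ba (fun b x)) (B-after-b a x)

  -- B preserves compatibility: B a ∘ b ⊑ b ∘ a ⊑ b ∘ B a.
  B-preserves-compatible : ∀ a → Compatible L b f a → Compatible L b f (B L b f a)
  B-preserves-compatible a compat =
      B-below-f a
    , λ x → trans (B-after-b a x) (monotone b (compatible⇒postfixed a compat x))

  ω-fixed : B L b f ω ≈ᴹ ω
  ω-fixed x = antisym
    (compatible⇒⊑ω (B L b f ω) (B-preserves-compatible ω ω-compatible) x)
    (compatible⇒postfixed ω ω-compatible x)

  fixed⇒⊑ω : ∀ y → B L b f y ≈ᴹ y → y ⊑ ω
  fixed⇒⊑ω y By≈y = compatible⇒⊑ω y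
    (postfixed⇒compatible y (λ x → reflexive (Eq.sym (By≈y x))))

theorem9p15 : {c ℓ₁ ℓ₂ : Level} (L : CompleteLattice c ℓ₁ ℓ₂ (c ⊔ ℓ₂))
    (b : Mono L) (f : CompleteLattice.Carrier L) →
    IsGreatestFixedPoint L (B L b f) (companion L b f)
theorem9p15 L b f = ω-fixed , fixed⇒⊑ω
  where open CompanionFixedPoint L b f
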